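{- Let ParAlg be nice with traps. Let $\sigma$ be a player, $G$ a parity game, $X_1\subseteq X_2$ vertex sets, and $A$ a $\overline\sigma$-trap in $G$ with $X_1\subseteq A$. Then $\mathrm{SeqAttr}(G[A],X_1,\sigma,\mathrm{ParAlg})\subseteq\mathrm{SeqAttr}(G,X_2,\sigma,\mathrm{ParAlg})$.
   Context: A parity game $G=(V,E,p)$: finite directed graph in which every vertex has an outgoing edge, priorities $p:V\to\mathbb Z$; even-priority vertices belong to Even, odd ones to Odd; $V_\sigma$ the vertices of $\sigma$, $\overline\sigma$ the opponent, $N(v)$ the successors of $v$. $\max(S)$ is the set of vertices of maximum priority in $S$; $p(S)$ the common priority of a set whose elements share one. A $\sigma$-trap is a set $X$ in which every $\sigma$-vertex has all successors in $X$ and every $\overline\sigma$-vertex has some successor in $X$; $G[X]$ is the induced subgraph. ParAlg (mapping a parity game and player to a vertex subset) is nice with traps if: (i) for every parity game $G$ and $\overline\sigma$-trap $A$, $\mathrm{ParAlg}(G[A],\sigma)\subseteq\mathrm{ParAlg}(G,\sigma)$; (ii) with $S=\mathrm{ParAlg}(G,\sigma)$, for every $\overline\sigma$-trap $A\supseteq S$, $\mathrm{ParAlg}(G[A],\sigma)=S$, and for every $\sigma$-trap $A$ with $A\cap S\ne\emptyset$, $\mathrm{ParAlg}(G[A],\sigma)\ne\emptyset$; (iii) $\mathrm{ParAlg}(G,\sigma)$ is always a $\overline\sigma$-trap whose largest priority belongs to $\sigma$. $\mathrm{Attr}(G,X,\sigma)$ is the least $C\supseteq X$ containing every $v\in V_\sigma$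 with $N(v)\cap C\ne\emptyset$ and every $v\in V_{\overline\sigma}$ with $N(v)\subseteq C$. $\mathrm{SafeAttr}(G,\lambda,X,\sigma)$ is the least $C\supseteq X$ containing every $v\in V_\sigma$ with $p(v)<\lambda$ and $N(v)\cap C\ne\emptyset$ and every $v\in V_{\overline\sigma}$ with $p(v)<\lambda$ and $N(v)\subseteq C$. $\mathrm{Restrict}(G,\lambda,\sigma)=V\setminus\mathrm{Attr}(G,\{v:p(v)\ge\lambda\},\overline\sigma)$. $\mathrm{GenAttr}(G,\lambda,X,\sigma,\mathrm{ParAlg})$: $C:=X$; repeatedly $S:=\mathrm{SafeAttr}(G,\lambda,C,\sigma)$, $V':=\mathrm{Restrict}(G[V\setminus S],\lambda,\sigma)$, $C':=S\cup\mathrm{ParAlg}(G[V'],\sigma)$; return $C'$ if $C'=C$, else $C:=C'$. $\mathrm{SeqAttr}(G,X,\sigma,\mathrm{ParAlg})$: $W:=V_\sigma\cap X$, $C:=\emptyset$; while $W\ne\emptyset$: $S:=\max(W)$, $C:=\mathrm{GenAttr}(G,p(S),C\cup S,\sigma,\mathrm{ParAlg})$, $W:=W\setminus C$; return $C$. -}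

module Defs where

open import Data.Bool using (Bool; true; false; _∧_; _∨_; not; if_then_else_)
open import Data.Nat using (ℕ; zero; suc)
open import Data.Integer using (ℤ; ∣_∣; _≤ᵇ_; _≤_)
import Data.Integer.Properties as ℤP
open import Data.Fin using (Fin)
open import Data.Fin.Subset using (Subset; _∈_; _⊆_; _∩_; _∪_; ∁; ⊥; Nonempty)
open import Data.Vec using (Vec; []; _∷_; tabulate; lookup; foldr)
open import Data.Vec.Properties using (≡-dec)
import Data.Bool.Properties as BoolP
open import Data.Maybe using (Maybe; just; nothing)
open import Data.Product using (∃; _×_; _,_)
open import Relation.Binary.PropositionalEquality using (_≡_)
open import Relation.Nullary using (yes; no)
open import Relation.Nullary.Decidable using (⌊_⌋)

data Player : Set where
  Even Odd : Player

opp : Player → Player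
opp Even = Odd
opp Odd  = Even

evenℕ : ℕ → Bool
evenℕ zero          = true
evenℕ (suc zero)    = false
evenℕ (suc (suc k)) = evenℕ k

ownerOf : ℤ → Player
ownerOf z = if evenℕ ∣ z ∣ then Even else Odd

_==P_ : Player → Player → Bool
Even ==P Even = true
Odd  ==P Odd  = true
_    ==P _    = false

-- Arenas over the ambient vertex universe Fin n.
-- V   : the vertex set of the game
-- E v : the (ambient) out-neighbourhood of v; only edges inside V count
-- p   : priorities

record Arena (n : ℕ) : Set where
  constructor arena
  field
    V : Subset n
    E : Fin n → Subset n
    p : Fin n → ℤ
open Arena public

owner : ∀ {n} → Arena n → Fin n → Player
owner G v = ownerOf (p G v)

N : ∀ {n} → Arena n → Fin n → Subset n
N G v = E G v ∩ V G

IsParityGame : ∀ {n} → Arena n → Set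
IsParityGame G = ∀ v → v ∈ V G → Nonempty (N G v)

_[_] : ∀ {n} → Arena n → Subset n → Arena n
G [ X ] = arena (V G ∩ X) (E G) (p G)

IsTrap : ∀ {n} → Arena n → Player → Subset n → Set
IsTrap G σ X =
  X ⊆ V G ×
  (∀ v → v ∈ X →
     (owner G v ≡ σ → ∀ w → w ∈ N G v → w ∈ X) ×
     (owner G v ≡ opp σ → ∃ λ w → w ∈ N G v × w ∈ X))

orV : ∀ {n} → Vec Bool n → Bool
orV = foldr _ _∨_ false

andV : ∀ {n} → Vec Bool n → Bool
andV = foldr _ _∧_ true

meets : ∀ {n} → Subset n → Subset n → Bool
meets A B = orV (A ∩ B)

incl : ∀ {n} → Subset n → Subset n → Bool
incl A B = andV (B ∪ ∁ A)

_≟S_ : ∀ {n} → Subset n → Subset n → Bool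
A ≟S B = ⌊ ≡-dec BoolP._≟_ A B ⌋

setOf : ∀ {n} → (Fin n → Bool) → Subset n
setOf = tabulate

iterate : ∀ {A : Set} → ℕ → (A → A) → A → A
iterate zero    f x = x
iterate (suc k) f x = iterate k f (f x)

-- Attractors.  The least C ⊇ X closed under the attractor rules is
-- computed as the limit of the increasing chain X ⊆ F X ⊆ F² X ⊆ …,
-- which stabilises after at most n steps since C ⊆ Fin n.

attrStep : ∀ {n} → Arena n → (Fin n → Bool) → Player → Subset n → Subset n
attrStep G ok σ C = C ∪ setOf λ v →
  lookup (V G) v ∧ ok v ∧
  (if owner G v ==P σ then meets (N G v) C else incl (N G v) C)

Attr : ∀ {n} → Arena n → Subset n → Player → Subset n
Attr {n} G X σ = iterate (suc n) (attrStep G (λ _ → true) σ) X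

SafeAttr : ∀ {n} → Arena n → ℤ → Subset n → Player → Subset n
SafeAttr {n} G λ′ X σ =
  iterate (suc n) (attrStep G (λ v → not (λ′ ≤ᵇ p G v)) σ) X

Restrict : ∀ {n} → Arena n → ℤ → Player → Subset n
Restrict G λ′ σ =
  V G ∩ ∁ (Attr G (setOf λ v → lookup (V G) v ∧ (λ′ ≤ᵇ p G v)) (opp σ))

ParAlgType : Set
ParAlgType = ∀ {n} → Arena n → Player → Subset n

record NiceWithTraps (ParAlg : ParAlgType) : Set where
  field
    trapMono : ∀ {n} (G : Arena n) (σ : Player) (A : Subset n) →
      IsParityGame G → IsTrap G (opp σ) A →
      ParAlg (G [ A ]) σ ⊆ ParAlg G σ
    trapStable : ∀ {n} (G : Arena n) (σ : Player) (A : Subset n) →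
      IsParityGame G → IsTrap G (opp σ) A → ParAlg G σ ⊆ A →
      ParAlg (G [ A ]) σ ≡ ParAlg G σ
    trapNonempty : ∀ {n} (G : Arena n) (σ : Player) (A : Subset n) →
      IsParityGame G → IsTrap G σ A → Nonempty (A ∩ ParAlg G σ) →
      Nonempty (ParAlg (G [ A ]) σ)
    isTrap : ∀ {n} (G : Arena n) (σ : Player) →
      IsParityGame G → IsTrap G (opp σ) (ParAlg G σ)
    topOwned : ∀ {n} (G : Arena n) (σ : Player) →
      IsParityGame G → ∀ v → v ∈ ParAlg G σ →
      (∀ w → w ∈ ParAlg G σ → p G w ≤ p G v) → owner G v ≡ σ

genStep : ∀ {n} → Arena n → ℤ → Player → ParAlgType → Subset n → Subset n
genStep G λ′ σ ParAlg C =
  let S  = SafeAttr G λ′ C σ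
      V′ = Restrict (G [ ∁ S ]) λ′ σ
  in S ∪ ParAlg (G [ V′ ]) σ

-- loop "repeat … until C′ = C" with fuel; C only grows (C ⊆ SafeAttr C ⊆ C′),
-- so at most n+1 strict increases occur and fuel n+2 always suffices.
genLoop : ∀ {n} → ℕ → Arena n → ℤ → Player → ParAlgType → Subset n → Subset n
genLoop zero     G λ′ σ ParAlg C = C
genLoop (suc k)  G λ′ σ ParAlg C =
  let C′ = genStep G λ′ σ ParAlg C
  in if C′ ≟S C then C′ else genLoop k G λ′ σ ParAlg C′

GenAttr : ∀ {n} → Arena n → ℤ → Subset n → Player → ParAlgType → Subset n
GenAttr {n} G λ′ X σ ParAlg = genLoop (suc (suc n)) G λ′ σ ParAlg X

maxPrio : ∀ {n} → Arena n → Subset n → Maybe ℤ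
maxPrio {zero}  G []           = nothing
maxPrio {suc n} G (b ∷ W) = go b (maxPrio {n} G′ W)
  where
    G′ : Arena n
    G′ = arena (Data.Vec.tail (V G)) (λ v → Data.Vec.tail (E G (Fin.suc v)))
               (λ v → p G (Fin.suc v))
    go : Bool → Maybe ℤ → Maybe ℤ
    go false m        = m
    go true  nothing  = just (p G Fin.zero)
    go true  (just z) = just (if z ≤ᵇ p G Fin.zero then p G Fin.zero else z)

-- while W ≠ ∅: S := max(W); C := GenAttr(G, p(S), C ∪ S); W := W ∖ C.
-- Each round removes S ≠ ∅ from W, so fuel n+1 always suffices.
seqLoop : ∀ {n} → ℕ → Arena n → Player → ParAlgType →
          Subset n → Subset n → Subset n
seqLoop zero    G σ ParAlg W C = C
seqLoop (suc k) G σ ParAlg W C with maxPrio G W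
... | nothing = C
... | just m  =
  let S  = setOf (λ v → lookup W v ∧ (m ≤ᵇ p G v) ∧ (p G v ≤ᵇ m))
      C′ = GenAttr G m (C ∪ S) σ ParAlg
  in seqLoop k G σ ParAlg (W ∩ ∁ C′) C′

SeqAttr : ∀ {n} → Arena n → Subset n → Player → ParAlgType → Subset n
SeqAttr {n} G X σ ParAlg =
  seqLoop (suc n) G σ ParAlg
    (setOf (λ v → lookup (V G) v ∧ lookup X v ∧ (owner G v ==P σ))) ⊥

-- Write R for SeqAttr(G, X₂) and R≥ m for the set that the run of SeqAttr on G has built once
-- all its targets of priority at least m are processed.  Each R≥ m is the output of a GenAttr
-- round at some priority L ≥ m, so it is closed under the GenAttr step of G at level L.
--
-- Core lemma: if R′ is closed under the GenAttr step of G at level L and l ≤ L, then the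
-- GenAttr step of the subgame G[A] at level l maps subsets of R′ into R′.  The safe attractor
-- stays in R′ because A is a σ̄-trap.  If ParAlg on the restricted game H of that step produced
-- a vertex outside R′, then B = V(H) ∖ R′ would be a σ-trap of H meeting ParAlg(H) and a σ̄-trap
-- of D = G[Restrict(G ∖ R′, L, σ)], and niceness would yield a vertex of ParAlg(D); but
-- ParAlg(D) ⊆ R′ by closedness while D avoids R′.
--
-- The targets of the run of SeqAttr on G[A] are targets of the run on G, and both process
-- priorities in decreasing order; by induction each round of the former at priority M stays
-- inside R≥ M ⊆ R.

module Submission where

open import Defs
open import Data.Bool using (Bool; true; false; _∧_; not; if_then_else_; T)
open import Data.Bool.Properties using (T-∧; T-≡; T-not-≡) renaming (_≟_ to _≟ᵇ_)
open import Data.Nat using (ℕ; zero; suc; _+_; s≤s; s≤s⁻¹) renaming (_≤_ to _≤ℕ_; _<_ to _<ℕ_)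
import Data.Nat.Properties as ℕ
open import Data.Integer using (ℤ; _≤ᵇ_; _≤_)
import Data.Integer.Properties as ℤ
open import Data.Fin using (Fin; zero; suc)
open import Data.Fin.Subset
  using (Subset; _∈_; _∉_; _⊆_; _⊂_; _∩_; _∪_; ∁; ⊥; Nonempty; ∣_∣; inside; outside)
open import Data.Fin.Subset.Properties
open import Data.Vec using (_∷_; []; here; there; lookup; tail)
open import Data.Vec.Properties using (lookup∘tabulate; []=⇒lookup; lookup⇒[]=; ≡-dec)
open import Data.Product using (∃; _×_; _,_; proj₁; proj₂)
open import Data.Sum using (_⊎_; inj₁; inj₂)
open import Data.Maybe using (Maybe; just; nothing)
open import Function using (_∘_; _⇔_; mk⇔; Equivalence)
open import Relation.Binary.PropositionalEquality
  using (_≡_; refl; sym; trans; cong; subst; module ≡-Reasoning)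
open import Relation.Nullary using (¬_; yes; no; does; contradiction)

open Equivalence using (to; from)

T-not⁺ : ∀ {b} → ¬ T b → T (not b)
T-not⁺ {false} _  = _
T-not⁺ {true}  ¬t = ¬t _

T-not⁻ : ∀ {b} → T (not b) → ¬ T b
T-not⁻ {false} _ ()

x∈p∩q⇒x∈p : ∀ {n} {p q : Subset n} {x} → x ∈ p ∩ q → x ∈ p
x∈p∩q⇒x∈p {p = p} {q} = proj₁ ∘ x∈p∩q⁻ p q

x∈p∩q⇒x∈q : ∀ {n} {p q : Subset n} {x} → x ∈ p ∩ q → x ∈ q
x∈p∩q⇒x∈q {p = p} {q} = proj₂ ∘ x∈p∩q⁻ p q

⊆⊎⊈ : ∀ {n} (p q : Subset n) → p ⊆ q ⊎ ∃ λ x → x ∈ p × x ∉ q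
⊆⊎⊈ p q with nonempty? (p ∩ ∁ q)
... | yes (x , x∈p∖q) = inj₂ (x , x∈p∩q⇒x∈p x∈p∖q , x∈∁p⇒x∉p (x∈p∩q⇒x∈q x∈p∖q))
... | no  p∖q-empty   = inj₁ p⊆q
  where
  p⊆q : p ⊆ q
  p⊆q {x} x∈p with x ∈? q
  ... | yes x∈q = x∈q
  ... | no  x∉q = contradiction (x , x∈p∩q⁺ (x∈p , x∉p⇒x∈∁p x∉q)) p∖q-empty

∪-least : ∀ {n} {p q r : Subset n} → p ⊆ r → q ⊆ r → p ∪ q ⊆ r
∪-least {p = p} {q} p⊆r q⊆r x∈ with x∈p∪q⁻ p q x∈
... | inj₁ x∈p = p⊆r x∈p
... | inj₂ x∈q = q⊆r x∈q

∈⇔T-lookup : ∀ {n} {p : Subset n} {x} → x ∈ p ⇔ T (lookup p x)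
∈⇔T-lookup {p = p} {x} = mk⇔
  (λ x∈p → from T-≡ ([]=⇒lookup x∈p))
  (λ t → lookup⇒[]= x p (to T-≡ t))

∈setOf⇔ : ∀ {n} {f : Fin n → Bool} {x} → x ∈ setOf f ⇔ T (f x)
∈setOf⇔ {f = f} {x} = mk⇔
  (λ x∈ → subst T (lookup∘tabulate f x) (to ∈⇔T-lookup x∈))
  (λ t → from ∈⇔T-lookup (subst T (sym (lookup∘tabulate f x)) t))

T-orV⇔Nonempty : ∀ {n} (p : Subset n) → T (orV p) ⇔ Nonempty p
T-orV⇔Nonempty p = mk⇔ (to⇒ p) (from⇒ p)
  where
  to⇒ : ∀ {n} (p : Subset n) → T (orV p) → Nonempty p
  to⇒ (inside  ∷ p) _ = zero , here
  to⇒ (outside ∷ p) t with to⇒ p t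
  ... | x , x∈p = suc x , there x∈p
  from⇒ : ∀ {n} (p : Subset n) → Nonempty p → T (orV p)
  from⇒ (inside  ∷ p) _                 = _
  from⇒ (outside ∷ p) (suc x , there x∈p) = from⇒ p (x , x∈p)

T-andV⇔Full : ∀ {n} (p : Subset n) → T (andV p) ⇔ (∀ x → x ∈ p)
T-andV⇔Full p = mk⇔ (to⇒ p) (from⇒ p)
  where
  to⇒ : ∀ {n} (p : Subset n) → T (andV p) → ∀ x → x ∈ p
  to⇒ (inside ∷ p) t zero    = here
  to⇒ (inside ∷ p) t (suc x) = there (to⇒ p t x)
  from⇒ : ∀ {n} (p : Subset n) → (∀ x → x ∈ p) → T (andV p)
  from⇒ []            _     = _
  from⇒ (inside  ∷ p) full  = from⇒ p (drop-there ∘ full ∘ suc)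
  from⇒ (outside ∷ p) full  with full zero
  ... | ()

T-meets⇔ : ∀ {n} (p q : Subset n) → T (meets p q) ⇔ Nonempty (p ∩ q)
T-meets⇔ p q = T-orV⇔Nonempty (p ∩ q)

T-incl⇔ : ∀ {n} (p q : Subset n) → T (incl p q) ⇔ p ⊆ q
T-incl⇔ p q = mk⇔ to⇒ from⇒
  where
  to⇒ : T (incl p q) → p ⊆ q
  to⇒ t {x} x∈p with x∈p∪q⁻ q (∁ p) (to (T-andV⇔Full (q ∪ ∁ p)) t x)
  ... | inj₁ x∈q  = x∈q
  ... | inj₂ x∈∁p = contradiction x∈p (x∈∁p⇒x∉p x∈∁p)
  from⇒ : p ⊆ q → T (incl p q)
  from⇒ p⊆q = from (T-andV⇔Full (q ∪ ∁ p)) cover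
    where
    cover : ∀ x → x ∈ q ∪ ∁ p
    cover x with x ∈? p
    ... | yes x∈p = x∈p∪q⁺ (inj₁ (p⊆q x∈p))
    ... | no  x∉p = x∈p∪q⁺ (inj₂ (x∉p⇒x∈∁p x∉p))

opp-involutive : ∀ σ → opp (opp σ) ≡ σ
opp-involutive Even = refl
opp-involutive Odd  = refl

≡-or-≡opp : ∀ σ τ → τ ≡ σ ⊎ τ ≡ opp σ
≡-or-≡opp Even Even = inj₁ refl
≡-or-≡opp Even Odd  = inj₂ refl
≡-or-≡opp Odd  Even = inj₂ refl
≡-or-≡opp Odd  Odd  = inj₁ refl

if-==P-self : ∀ {τ σ} {A : Set} {a b : A} → τ ≡ σ → (if τ ==P σ then a else b) ≡ a
if-==P-self {Even} refl = refl
if-==P-self {Odd}  refl = refl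

if-==P-opp : ∀ {τ σ} {A : Set} {a b : A} → τ ≡ opp σ → (if τ ==P σ then a else b) ≡ b
if-==P-opp {σ = Even} refl = refl
if-==P-opp {σ = Odd}  refl = refl

-- One attractor step

data Attracted {n} (G : Arena n) (σ : Player) (C : Subset n) (v : Fin n) : Set where
  chosen : ∀ {w} → owner G v ≡ σ → w ∈ N G v → w ∈ C → Attracted G σ C v
  forced : owner G v ≡ opp σ → N G v ⊆ C → Attracted G σ C v

module _ {n} {G : Arena n} {σ : Player} {C : Subset n} {v : Fin n} where
  private
    attracts : Bool
    attracts = if owner G v ==P σ then meets (N G v) C else incl (N G v) C

  Attracted⇔T : Attracted G σ C v ⇔ T attracts
  Attracted⇔T = mk⇔ to⇒ from⇒
    where
    to⇒ : Attracted G σ C v → T attracts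
    to⇒ (chosen o w∈N w∈C) =
      subst T (sym (if-==P-self o)) (from (T-meets⇔ (N G v) C) (_ , x∈p∩q⁺ (w∈N , w∈C)))
    to⇒ (forced o N⊆C) =
      subst T (sym (if-==P-opp o)) (from (T-incl⇔ (N G v) C) N⊆C)
    from⇒ : T attracts → Attracted G σ C v
    from⇒ t with ≡-or-≡opp σ (owner G v)
    ... | inj₁ o with to (T-meets⇔ (N G v) C) (subst T (if-==P-self o) t)
    ...   | w , w∈N∩C = chosen o (x∈p∩q⇒x∈p w∈N∩C) (x∈p∩q⇒x∈q w∈N∩C)
    from⇒ t | inj₂ o = forced o (to (T-incl⇔ (N G v) C) (subst T (if-==P-opp o) t))

module _ {n} (G : Arena n) (ok : Fin n → Bool) (σ : Player) (C : Subset n) where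

  ⊆-attrStep : C ⊆ attrStep G ok σ C
  ⊆-attrStep = x∈p∪q⁺ ∘ inj₁

  attrStep⁺ : ∀ {v} → v ∈ V G → T (ok v) → Attracted G σ C v → v ∈ attrStep G ok σ C
  attrStep⁺ v∈V okv att = x∈p∪q⁺ (inj₂ (from ∈setOf⇔
    (from T-∧ (to ∈⇔T-lookup v∈V , from T-∧ (okv , to Attracted⇔T att)))))

  attrStep⁻ : ∀ {v} → v ∈ attrStep G ok σ C →
              v ∈ C ⊎ (v ∈ V G × T (ok v) × Attracted G σ C v)
  attrStep⁻ v∈ with x∈p∪q⁻ C _ v∈
  ... | inj₁ v∈C   = inj₁ v∈C
  ... | inj₂ v∈new with to T-∧ (to ∈setOf⇔ v∈new)
  ...   | inV , rest with to T-∧ rest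
  ...     | okv , att = inj₂ (from ∈⇔T-lookup inV , okv , from Attracted⇔T att)

below : ∀ {n} → Arena n → ℤ → Fin n → Bool
below G l v = not (l ≤ᵇ p G v)

T-below⇔ : ∀ {n} {G : Arena n} {l v} → T (below G l v) ⇔ (¬ l ≤ p G v)
T-below⇔ = mk⇔ (λ t → T-not⁻ t ∘ ℤ.≤⇒≤ᵇ) (λ h → T-not⁺ (h ∘ ℤ.≤ᵇ⇒≤))

-- Fixed points of inflationary maps on subsets

⊆⇒≡⊎⊂ : ∀ {n} {p q : Subset n} → p ⊆ q → p ≡ q ⊎ p ⊂ q
⊆⇒≡⊎⊂ {p = []}    {[]}    _   = inj₁ refl
⊆⇒≡⊎⊂ {p = x ∷ p} {y ∷ q} x∷p⊆y∷q with ⊆⇒≡⊎⊂ (drop-∷-⊆ x∷p⊆y∷q)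
... | inj₂ (p⊆q , z , z∈q , z∉p) =
  inj₂ (x∷p⊆y∷q , suc z , there z∈q , z∉p ∘ drop-there)
⊆⇒≡⊎⊂ {p = outside ∷ p} {outside ∷ q} _ | inj₁ refl = inj₁ refl
⊆⇒≡⊎⊂ {p = inside  ∷ p} {inside  ∷ q} _ | inj₁ refl = inj₁ refl
⊆⇒≡⊎⊂ {p = outside ∷ p} {inside  ∷ q} x∷p⊆y∷q | inj₁ refl =
  inj₂ (x∷p⊆y∷q , zero , here , λ ())
⊆⇒≡⊎⊂ {p = inside  ∷ p} {outside ∷ q} x∷p⊆y∷q | inj₁ refl with x∷p⊆y∷q here
... | ()

module _ {A : Set} (f : A → A) where

  iterate-preserves : (P : A → Set) → (∀ x → P x → P (f x)) → ∀ k x → P x → P (iterate k f x)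
  iterate-preserves P step zero    x px = px
  iterate-preserves P step (suc k) x px = iterate-preserves P step k (f x) (step x px)

  iterate-fixed : ∀ k x → f x ≡ x → iterate k f x ≡ x
  iterate-fixed zero    x fx≡x = refl
  iterate-fixed (suc k) x fx≡x rewrite fx≡x = iterate-fixed k x fx≡x

module _ {n} (f : Subset n → Subset n) (inflationary : ∀ X → X ⊆ f X) where

  ⊆-iterate : ∀ k X → X ⊆ iterate k f X
  ⊆-iterate k X = iterate-preserves f (X ⊆_) (λ Y X⊆Y → inflationary Y ∘ X⊆Y) k X (λ x∈ → x∈)

  iterate-fixed-or-grows : ∀ k X →
    f (iterate k f X) ≡ iterate k f X ⊎ k + ∣ X ∣ ≤ℕ ∣ iterate k f X ∣
  iterate-fixed-or-grows zero    X = inj₂ ℕ.≤-refl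
  iterate-fixed-or-grows (suc k) X with ⊆⇒≡⊎⊂ (inflationary X)
  ... | inj₁ X≡fX =
    inj₁ (subst (λ Y → f Y ≡ Y) (sym (iterate-fixed f (suc k) X (sym X≡fX))) (sym X≡fX))
  ... | inj₂ X⊂fX with iterate-fixed-or-grows k (f X)
  ...   | inj₁ fixed = inj₁ fixed
  ...   | inj₂ grows = inj₂ (begin
            suc k + ∣ X ∣  ≡⟨ sym (ℕ.+-suc k ∣ X ∣) ⟩
            k + suc ∣ X ∣  ≤⟨ ℕ.+-monoʳ-≤ k (p⊂q⇒∣p∣<∣q∣ X⊂fX) ⟩
            k + ∣ f X ∣    ≤⟨ grows ⟩
            ∣ iterate k f (f X) ∣ ∎)
    where open ℕ.≤-Reasoning

  iterate-fixpoint : ∀ k X → n <ℕ k → f (iterate k f X) ≡ iterate k f X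
  iterate-fixpoint k X n<k with iterate-fixed-or-grows k X
  ... | inj₁ fixed = fixed
  ... | inj₂ grows = contradiction
          (ℕ.≤-trans (ℕ.≤-trans n<k (ℕ.m≤m+n k ∣ X ∣)) grows)
          (ℕ.≤⇒≯ (∣p∣≤n (iterate k f X)))

-- Subgames and traps

module _ {n} (G : Arena n) (X : Subset n) {v w : Fin n} where

  N[]⁺ : w ∈ N G v → w ∈ X → w ∈ N (G [ X ]) v
  N[]⁺ w∈N w∈X = x∈p∩q⁺ (x∈p∩q⇒x∈p w∈N , x∈p∩q⁺ (x∈p∩q⇒x∈q w∈N , w∈X))

  N[]⁻ : w ∈ N (G [ X ]) v → w ∈ N G v × w ∈ X
  N[]⁻ w∈N with x∈p∩q⁻ (V G) X (x∈p∩q⇒x∈q w∈N)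
  ... | w∈V , w∈X = x∈p∩q⁺ (x∈p∩q⇒x∈p w∈N , w∈V) , w∈X

[]-absorb : ∀ {n} (G : Arena n) {X : Subset n} → X ⊆ V G → G [ X ] ≡ arena X (E G) (p G)
[]-absorb G {X} X⊆V = cong (λ U → arena U (E G) (p G))
  (⊆-antisym (p∩q⊆q (V G) X) (λ x∈X → x∈p∩q⁺ (X⊆V x∈X , x∈X)))

module _ {n} {G : Arena n} {τ : Player} {B : Subset n} where

  trap⇒isParityGame : IsTrap G τ B → (∀ v → v ∈ B → owner G v ≡ τ → Nonempty (N G v)) →
                      IsParityGame (G [ B ])
  trap⇒isParityGame (_ , closed) has-succ v v∈ with x∈p∩q⇒x∈q v∈ | ≡-or-≡opp τ (owner G v)
  ... | v∈B | inj₁ o with has-succ v v∈B o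
  ...   | w , w∈N = w , N[]⁺ G B w∈N (proj₁ (closed v v∈B) o w w∈N)
  trap⇒isParityGame (_ , closed) has-succ v v∈ | v∈B | inj₂ o with proj₂ (closed v v∈B) o
  ...   | w , w∈N , w∈B = w , N[]⁺ G B w∈N w∈B

  trap-[] : ∀ {U} → IsTrap G τ B → B ⊆ U → IsTrap (G [ U ]) τ B
  trap-[] (B⊆V , closed) B⊆U = (λ v∈B → x∈p∩q⁺ (B⊆V v∈B , B⊆U v∈B)) , λ v v∈B →
    (λ o w w∈N → proj₁ (closed v v∈B) o w (proj₁ (N[]⁻ G _ w∈N))) ,
    (λ o → let (w , w∈N , w∈B) = proj₂ (closed v v∈B) o in w , N[]⁺ G _ w∈N (B⊆U w∈B) , w∈B)

  trap-avoids-Attr : ∀ {X} → (∀ {v} → v ∈ B → v ∉ X) → IsTrap G τ B →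
                     ∀ {v} → v ∈ B → v ∉ Attr G X τ
  trap-avoids-Attr {X} B∩X≡∅ (_ , closed) =
    iterate-preserves (attrStep G (λ _ → true) τ) Avoids step (suc n) X B∩X≡∅
    where
    Avoids : Subset n → Set
    Avoids Y = ∀ {v} → v ∈ B → v ∉ Y
    step : ∀ Y → Avoids Y → Avoids (attrStep G (λ _ → true) τ Y)
    step Y avoids {v} v∈B v∈ with attrStep⁻ G (λ _ → true) τ Y v∈
    ... | inj₁ v∈Y = avoids v∈B v∈Y
    ... | inj₂ (_ , _ , chosen o w∈N w∈Y) = avoids (proj₁ (closed v v∈B) o _ w∈N) w∈Y
    ... | inj₂ (_ , _ , forced o N⊆Y) with proj₂ (closed v v∈B) o
    ...   | w , w∈N , w∈B = avoids w∈B (N⊆Y w∈N)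

-- Attractors and restricted games

module _ {n} (G : Arena n) (ok : Fin n → Bool) (σ : Player) (X : Subset n) where

  ⊆-attractor : X ⊆ iterate (suc n) (attrStep G ok σ) X
  ⊆-attractor = ⊆-iterate (attrStep G ok σ) (⊆-attrStep G ok σ) (suc n) X

  attractor-closed : attrStep G ok σ (iterate (suc n) (attrStep G ok σ) X) ⊆
                     iterate (suc n) (attrStep G ok σ) X
  attractor-closed = ⊆-reflexive
    (iterate-fixpoint (attrStep G ok σ) (⊆-attrStep G ok σ) (suc n) X (ℕ.n<1+n n))

high : ∀ {n} → Arena n → ℤ → Subset n
high H l = setOf λ v → lookup (V H) v ∧ (l ≤ᵇ p H v)

module _ {n} {H : Arena n} {l : ℤ} {v : Fin n} where

  high⁺ : v ∈ V H → l ≤ p H v → v ∈ high H l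
  high⁺ v∈V l≤p = from ∈setOf⇔ (from T-∧ (to ∈⇔T-lookup v∈V , ℤ.≤⇒≤ᵇ l≤p))

  high⁻ : v ∈ high H l → l ≤ p H v
  high⁻ v∈ = ℤ.≤ᵇ⇒≤ (proj₂ (to T-∧ (to ∈setOf⇔ v∈)))

module _ {n} {H : Arena n} {l : ℤ} {σ : Player} where
  private
    attr : Subset n
    attr = Attr H (high H l) (opp σ)

    escapes : ∀ {v} → v ∈ Restrict H l σ → v ∉ attrStep H (λ _ → true) (opp σ) attr
    escapes v∈ = x∈∁p⇒x∉p (x∈p∩q⇒x∈q v∈) ∘ attractor-closed H (λ _ → true) (opp σ) (high H l)

  Restrict-below : ∀ {v} → v ∈ Restrict H l σ → ¬ l ≤ p H v
  Restrict-below {v} v∈ l≤p = x∈∁p⇒x∉p (x∈p∩q⇒x∈q v∈)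
    (⊆-attractor H (λ _ → true) (opp σ) (high H l) (high⁺ {H = H} (x∈p∩q⇒x∈p v∈) l≤p))

  Restrict-isTrap : IsTrap H (opp σ) (Restrict H l σ)
  Restrict-isTrap = x∈p∩q⇒x∈p , λ v v∈ →
    (λ o w w∈N → x∈p∩q⁺ (x∈p∩q⇒x∈q w∈N , x∉p⇒x∈∁p λ w∈A →
      escapes v∈ (attrStep⁺ H _ (opp σ) attr (x∈p∩q⇒x∈p v∈) _ (chosen o w∈N w∈A)))) ,
    (λ o → some-succ v∈ o (⊆⊎⊈ (N H v) attr))
    where
    some-succ : ∀ {v} → v ∈ Restrict H l σ → owner H v ≡ opp (opp σ) →
                N H v ⊆ attr ⊎ (∃ λ w → w ∈ N H v × w ∉ attr) →
                ∃ λ w → w ∈ N H v × w ∈ Restrict H l σ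
    some-succ v∈ o (inj₁ N⊆A) =
      contradiction (attrStep⁺ H _ (opp σ) attr (x∈p∩q⇒x∈p v∈) _ (forced o N⊆A)) (escapes v∈)
    some-succ v∈ o (inj₂ (w , w∈N , w∉A)) = w , w∈N , x∈p∩q⁺ (x∈p∩q⇒x∈q w∈N , x∉p⇒x∈∁p w∉A)

-- An opp σ-vertex outside S and below l keeps a successor outside S since S is closed.
Restrict-isParityGame : ∀ {n} {H : Arena n} {l σ S} → attrStep H (below H l) σ S ⊆ S →
                        IsParityGame (H [ Restrict (H [ ∁ S ]) l σ ])
Restrict-isParityGame {n} {H} {l} {σ} {S} closed =
  subst IsParityGame (trans ([]-absorb (H [ ∁ S ]) R⊆V∖S) (sym ([]-absorb H (x∈p∩q⇒x∈p ∘ R⊆V∖S))))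
    (trap⇒isParityGame {G = H [ ∁ S ]} (Restrict-isTrap {H = H [ ∁ S ]} {l} {σ}) has-succ)
  where
  R⊆V∖S : Restrict (H [ ∁ S ]) l σ ⊆ V H ∩ ∁ S
  R⊆V∖S = x∈p∩q⇒x∈p
  has-succ : ∀ v → v ∈ Restrict (H [ ∁ S ]) l σ → owner H v ≡ opp σ → Nonempty (N (H [ ∁ S ]) v)
  has-succ v v∈ o with x∈p∩q⁻ (V H) (∁ S) (x∈p∩q⇒x∈p v∈) | ⊆⊎⊈ (N H v) S
  ... | v∈V , v∉S | inj₁ N⊆S =
    contradiction (closed (attrStep⁺ H (below H l) σ S v∈V v-below (forced o N⊆S))) (x∈∁p⇒x∉p v∉S)
    where
    v-below : T (below H l v)
    v-below = from (T-below⇔ {G = H}) (Restrict-below {H = H [ ∁ S ]} {l} {σ} v∈)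
  ... | _ | inj₂ (w , w∈N , w∉S) = w , N[]⁺ H (∁ S) w∈N (x∉p⇒x∈∁p w∉S)

-- GenAttr

module _ {n} (G : Arena n) (l : ℤ) (σ : Player) (P : ParAlgType) where

  ⊆-genStep : ∀ C → C ⊆ genStep G l σ P C
  ⊆-genStep C = x∈p∪q⁺ ∘ inj₁ ∘ ⊆-attractor G (below G l) σ C

  genLoop≡iterate : ∀ k C → genLoop k G l σ P C ≡ iterate k (genStep G l σ P) C
  genLoop≡iterate zero    C = refl
  genLoop≡iterate (suc k) C with ≡-dec _≟ᵇ_ (genStep G l σ P C) C
  ... | yes fixed = trans fixed (sym (iterate-fixed (genStep G l σ P) (suc k) C fixed))
  ... | no  _     = genLoop≡iterate k (genStep G l σ P C)

  private
    GenAttr≡iterate : ∀ X → GenAttr G l X σ P ≡ iterate (suc (suc n)) (genStep G l σ P) X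
    GenAttr≡iterate = genLoop≡iterate (suc (suc n))

  ⊆-GenAttr : ∀ X → X ⊆ GenAttr G l X σ P
  ⊆-GenAttr X = ⊆-reflexive (sym (GenAttr≡iterate X)) ∘ ⊆-iterate _ ⊆-genStep (suc (suc n)) X

  GenAttr-fixpoint : ∀ X → genStep G l σ P (GenAttr G l X σ P) ≡ GenAttr G l X σ P
  GenAttr-fixpoint X = begin
    f (GenAttr G l X σ P)          ≡⟨ cong f (GenAttr≡iterate X) ⟩
    f (iterate (suc (suc n)) f X)  ≡⟨ iterate-fixpoint f ⊆-genStep (suc (suc n)) X n<2+n ⟩
    iterate (suc (suc n)) f X      ≡⟨ sym (GenAttr≡iterate X) ⟩
    GenAttr G l X σ P              ∎
    where
    open ≡-Reasoning
    f : Subset n → Subset n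
    f = genStep G l σ P
    n<2+n : n <ℕ suc (suc n)
    n<2+n = ℕ.m<n⇒m<1+n (ℕ.n<1+n n)

  GenAttr⊆ : ∀ {X R} → (∀ C → C ⊆ R → genStep G l σ P C ⊆ R) → X ⊆ R → GenAttr G l X σ P ⊆ R
  GenAttr⊆ {X} {R} step X⊆R =
    iterate-preserves _ (_⊆ R) step (suc (suc n)) X X⊆R ∘ ⊆-reflexive (GenAttr≡iterate X)

  module _ {R : Subset n} (closed : genStep G l σ P R ⊆ R) where
    private
      SafeAttr≡ : SafeAttr G l R σ ≡ R
      SafeAttr≡ = ⊆-antisym (closed ∘ x∈p∪q⁺ ∘ inj₁) (⊆-attractor G (below G l) σ R)

    genStep-closed⇒attrStep-closed : attrStep G (below G l) σ R ⊆ R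
    genStep-closed⇒attrStep-closed =
      subst (λ S → attrStep G (below G l) σ S ⊆ S) SafeAttr≡ (attractor-closed G (below G l) σ R)

    genStep-closed⇒ParAlg⊆ : P (G [ Restrict (G [ ∁ R ]) l σ ]) σ ⊆ R
    genStep-closed⇒ParAlg⊆ =
      subst (λ S → P (G [ Restrict (G [ ∁ S ]) l σ ]) σ ⊆ R) SafeAttr≡ (closed ∘ x∈p∪q⁺ ∘ inj₂)

Attracted-[] : ∀ {n} (G : Arena n) (A : Subset n) {σ Y R v} → IsTrap G (opp σ) A → v ∈ A → Y ⊆ R →
               Attracted (G [ A ]) σ Y v → Attracted G σ R v
Attracted-[] G A _ _ Y⊆R (chosen o w∈N w∈Y) = chosen o (proj₁ (N[]⁻ G A w∈N)) (Y⊆R w∈Y)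
Attracted-[] G A (_ , closed) v∈A Y⊆R (forced o N⊆Y) =
  forced o λ w∈N → Y⊆R (N⊆Y (N[]⁺ G A w∈N (proj₁ (closed _ v∈A) o _ w∈N)))

module GenStepInTrap (P : ParAlgType) (nice : NiceWithTraps P) {n} {G : Arena n} {σ : Player}
  {A : Subset n} (A-trap : IsTrap G (opp σ) A) {l l′ : ℤ} (l≤l′ : l ≤ l′) {R : Subset n}
  (R-closed : genStep G l′ σ P R ⊆ R) where

  open NiceWithTraps nice

  private
    R-attrClosed : attrStep G (below G l′) σ R ⊆ R
    R-attrClosed = genStep-closed⇒attrStep-closed G l′ σ P R-closed

    raise : ∀ {v} → T (below G l v) → T (below G l′ v)
    raise {v} t = from (T-below⇔ {G = G} {l′} {v}) λ l′≤p →
      to (T-below⇔ {G = G} {l} {v}) t (ℤ.≤-trans l≤l′ l′≤p)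

  SafeAttr[]⊆ : ∀ {C} → C ⊆ R → SafeAttr (G [ A ]) l C σ ⊆ R
  SafeAttr[]⊆ {C} C⊆R =
    iterate-preserves (attrStep (G [ A ]) (below (G [ A ]) l) σ) (_⊆ R) step (suc n) C C⊆R
    where
    step : ∀ Y → Y ⊆ R → attrStep (G [ A ]) (below (G [ A ]) l) σ Y ⊆ R
    step Y Y⊆R v∈ with attrStep⁻ (G [ A ]) (below (G [ A ]) l) σ Y v∈
    ... | inj₁ v∈Y = Y⊆R v∈Y
    ... | inj₂ (v∈V∩A , ok , att) with x∈p∩q⁻ (V G) A v∈V∩A
    ...   | v∈V , v∈A = R-attrClosed
            (attrStep⁺ G (below G l′) σ R v∈V (raise ok) (Attracted-[] G A A-trap v∈A Y⊆R att))

  module _ {C : Subset n} (C⊆R : C ⊆ R) where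
    private
      SA : Subset n
      SA = SafeAttr (G [ A ]) l C σ

      H : Arena n
      H = (G [ A ]) [ Restrict ((G [ A ]) [ ∁ SA ]) l σ ]

      VD : Subset n
      VD = Restrict (G [ ∁ R ]) l′ σ

      D : Arena n
      D = G [ VD ]

      B : Subset n
      B = V H ∩ ∁ R

      H-isParityGame : IsParityGame H
      H-isParityGame = Restrict-isParityGame {H = G [ A ]} {l} {σ} {SA}
        (attractor-closed (G [ A ]) (below (G [ A ]) l) σ C)

      D-isParityGame : IsParityGame D
      D-isParityGame = Restrict-isParityGame {H = G} {l′} {σ} {R} R-attrClosed

      H-below : ∀ {v} → v ∈ V H → T (below G l′ v)
      H-below v∈ =
        raise (from (T-below⇔ {G = G} {l})
                    (Restrict-below {H = G [ A ] [ ∁ SA ]} {l} {σ} (x∈p∩q⇒x∈q v∈)))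

      V-H⇒V-G : ∀ {v} → v ∈ V H → v ∈ V G
      V-H⇒V-G = x∈p∩q⇒x∈p ∘ x∈p∩q⇒x∈p

      escapes-R : ∀ {v} → v ∈ V H → v ∉ R → ¬ Attracted G σ R v
      escapes-R v∈ v∉R att = v∉R (R-attrClosed (attrStep⁺ G _ σ R (V-H⇒V-G v∈) (H-below v∈) att))

      opp-succ-in-H : ∀ {v w} → v ∈ V H → owner G v ≡ opp σ → w ∈ N G v → w ∉ R → w ∈ V H
      opp-succ-in-H {v} {w} v∈ o w∈N w∉R with x∈p∩q⁻ (V G ∩ A) _ v∈
      ... | v∈V∩A , v∈Res = x∈p∩q⁺ (w∈V∩A , stays w (N[]⁺ (G [ A ]) (∁ SA) (N[]⁺ G A w∈N w∈A) w∉SA))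
        where
        stays : ∀ w → w ∈ N (G [ A ] [ ∁ SA ]) v → w ∈ Restrict (G [ A ] [ ∁ SA ]) l σ
        stays = proj₁ (proj₂ (Restrict-isTrap {H = G [ A ] [ ∁ SA ]} {l} {σ}) v v∈Res) o
        w∉SA : w ∈ ∁ SA
        w∉SA = x∉p⇒x∈∁p (w∉R ∘ SafeAttr[]⊆ C⊆R)
        w∈A : w ∈ A
        w∈A = proj₁ (proj₂ A-trap v (x∈p∩q⇒x∈q v∈V∩A)) o w w∈N
        w∈V∩A : w ∈ V G ∩ A
        w∈V∩A = x∈p∩q⁺ (x∈p∩q⇒x∈q w∈N , w∈A)

      B-σtrap : IsTrap H σ B
      B-σtrap = x∈p∩q⇒x∈p , λ v v∈B → all-succ v∈B , some-succ v∈B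
        where
        all-succ : ∀ {v} → v ∈ B → owner G v ≡ σ → ∀ w → w ∈ N H v → w ∈ B
        all-succ {v} v∈B o w w∈N with w ∈? R
        ... | no  w∉R = x∈p∩q⁺ (x∈p∩q⇒x∈q w∈N , x∉p⇒x∈∁p w∉R)
        ... | yes w∈R = contradiction
                (chosen o (x∈p∩q⁺ (x∈p∩q⇒x∈p w∈N , V-H⇒V-G (x∈p∩q⇒x∈q w∈N))) w∈R)
                (escapes-R (x∈p∩q⇒x∈p v∈B) (x∈∁p⇒x∉p (x∈p∩q⇒x∈q v∈B)))
        some-succ : ∀ {v} → v ∈ B → owner G v ≡ opp σ → ∃ λ w → w ∈ N H v × w ∈ B
        some-succ {v} v∈B o with x∈p∩q⁻ (V H) (∁ R) v∈B | ⊆⊎⊈ (N G v) R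
        ... | v∈H , v∉R | inj₁ N⊆R = contradiction (forced o N⊆R) (escapes-R v∈H (x∈∁p⇒x∉p v∉R))
        ... | v∈H , _   | inj₂ (w , w∈N , w∉R) =
          w , x∈p∩q⁺ (x∈p∩q⇒x∈p w∈N , w∈H) , x∈p∩q⁺ (w∈H , x∉p⇒x∈∁p w∉R)
          where w∈H = opp-succ-in-H v∈H o w∈N w∉R

      B-trap-outside-R : IsTrap (G [ ∁ R ]) (opp σ) B
      B-trap-outside-R = B⊆V∖R , λ v v∈B → all-succ v∈B , some-succ v∈B
        where
        B⊆V∖R : B ⊆ V G ∩ ∁ R
        B⊆V∖R v∈B = x∈p∩q⁺ (V-H⇒V-G (x∈p∩q⇒x∈p v∈B) , x∈p∩q⇒x∈q v∈B)
        all-succ : ∀ {v} → v ∈ B → owner G v ≡ opp σ → ∀ w → w ∈ N (G [ ∁ R ]) v → w ∈ B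
        all-succ v∈B o w w∈N with N[]⁻ G (∁ R) w∈N
        ... | w∈N′ , w∉R = x∈p∩q⁺ (opp-succ-in-H (x∈p∩q⇒x∈p v∈B) o w∈N′ (x∈∁p⇒x∉p w∉R) , w∉R)
        some-succ : ∀ {v} → v ∈ B → owner G v ≡ opp (opp σ) → ∃ λ w → w ∈ N (G [ ∁ R ]) v × w ∈ B
        some-succ {v} v∈B o with H-isParityGame v (x∈p∩q⇒x∈p v∈B)
        ... | w , w∈N = w , x∈p∩q⁺ (x∈p∩q⇒x∈p w∈N , B⊆V∖R w∈B) , w∈B
          where
          w∈B : w ∈ B
          w∈B = proj₁ (proj₂ B-σtrap v v∈B) (trans o (opp-involutive σ)) w w∈N

      B⊆VD : B ⊆ VD
      B⊆VD v∈B = x∈p∩q⁺ (proj₁ B-trap-outside-R v∈B , x∉p⇒x∈∁p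
        (trap-avoids-Attr {G = G [ ∁ R ]} {opp σ} {B} {high (G [ ∁ R ]) l′}
          (λ v∈B′ v∈high →
            to (T-below⇔ {G = G} {l′}) (H-below (x∈p∩q⇒x∈p v∈B′)) (high⁻ {H = G [ ∁ R ]} v∈high))
          B-trap-outside-R v∈B))

      VD⊆V∖R : VD ⊆ V G ∩ ∁ R
      VD⊆V∖R = x∈p∩q⇒x∈p

      B-trap-D : IsTrap D (opp σ) B
      B-trap-D = subst (λ X → IsTrap X (opp σ) B)
        (trans ([]-absorb (G [ ∁ R ]) VD⊆V∖R) (sym ([]-absorb G (x∈p∩q⇒x∈p ∘ VD⊆V∖R))))
        (trap-[] {G = G [ ∁ R ]} {opp σ} {B} {VD} B-trap-outside-R B⊆VD)

      H[B]≡D[B] : H [ B ] ≡ D [ B ]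
      H[B]≡D[B] = trans ([]-absorb H x∈p∩q⇒x∈p) (sym ([]-absorb D (proj₁ B-trap-D)))

      ParAlg-D-empty : ∀ {v} → v ∉ P D σ
      ParAlg-D-empty v∈ =
        x∈∁p⇒x∉p (x∈p∩q⇒x∈q (VD⊆V∖R (x∈p∩q⇒x∈q (proj₁ (isTrap D σ D-isParityGame) v∈))))
                 (genStep-closed⇒ParAlg⊆ G l′ σ P R-closed v∈)

    ParAlg[]⊆ : P H σ ⊆ R
    ParAlg[]⊆ {v} v∈Q with v ∈? R
    ... | yes v∈R = v∈R
    ... | no  v∉R =
      let v∈B     = x∈p∩q⁺ (proj₁ (isTrap H σ H-isParityGame) v∈Q , x∉p⇒x∈∁p v∉R)
          (w , w∈) = trapNonempty H σ B H-isParityGame B-σtrap (v , x∈p∩q⁺ (v∈B , v∈Q))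
      in contradiction (trapMono D σ B D-isParityGame B-trap-D (subst (λ X → w ∈ P X σ) H[B]≡D[B] w∈))
                       ParAlg-D-empty

    genStep[]⊆ : genStep (G [ A ]) l σ P C ⊆ R
    genStep[]⊆ v∈ with x∈p∪q⁻ SA (P H σ) v∈
    ... | inj₁ v∈SA = SafeAttr[]⊆ C⊆R v∈SA
    ... | inj₂ v∈Q  = ParAlg[]⊆ v∈Q

-- Runs of SeqAttr

data MaxPrio {n} (G : Arena n) (W : Subset n) : Maybe ℤ → Set where
  empty    : (∀ v → v ∉ W) → MaxPrio G W nothing
  attained : ∀ {m v} → v ∈ W → p G v ≡ m → (∀ w → w ∈ W → p G w ≤ m) → MaxPrio G W (just m)

tailArena : ∀ {n} → Arena (suc n) → Arena n
tailArena G = arena (tail (V G)) (λ v → tail (E G (suc v))) (λ v → p G (suc v))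

maxPrio-spec : ∀ {n} (G : Arena n) W → MaxPrio G W (maxPrio G W)
maxPrio-spec {zero}  G []      = empty λ _ ()
maxPrio-spec {suc n} G (b ∷ W) with maxPrio (tailArena G) W | maxPrio-spec (tailArena G) W
maxPrio-spec G (outside ∷ W) | _ | empty W-empty =
  empty λ { zero () ; (suc v) (there v∈) → W-empty v v∈ }
maxPrio-spec G (outside ∷ W) | _ | attained v∈ refl bound =
  attained (there v∈) refl λ { (suc w) (there w∈) → bound w w∈ }
maxPrio-spec G (inside ∷ W) | _ | empty W-empty =
  attained here refl λ { zero _ → ℤ.≤-refl ; (suc w) (there w∈) → contradiction w∈ (W-empty w) }
maxPrio-spec G (inside ∷ W) | just m | attained v∈ refl bound with m ℤ.≤? p G zero
... | yes m≤p₀ rewrite to T-≡ (ℤ.≤⇒≤ᵇ m≤p₀) =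
  attained here refl λ { zero _ → ℤ.≤-refl ; (suc w) (there w∈) → ℤ.≤-trans (bound w w∈) m≤p₀ }
... | no  m≰p₀ rewrite to T-not-≡ (T-not⁺ (m≰p₀ ∘ ℤ.≤ᵇ⇒≤)) =
  attained (there v∈) refl λ { zero _ → ℤ.<⇒≤ (ℤ.≰⇒> m≰p₀) ; (suc w) (there w∈) → bound w w∈ }

maxLayer : ∀ {n} → Arena n → Subset n → ℤ → Subset n
maxLayer G W m = setOf λ v → lookup W v ∧ (m ≤ᵇ p G v) ∧ (p G v ≤ᵇ m)

module _ {n} {G : Arena n} {W : Subset n} {m : ℤ} {v : Fin n} where

  ∈maxLayer : v ∈ W → p G v ≡ m → v ∈ maxLayer G W m
  ∈maxLayer v∈W refl = from ∈setOf⇔ (from T-∧ (to ∈⇔T-lookup v∈W , from T-∧ (pv≤pv , pv≤pv)))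
    where
    pv≤pv : T (p G v ≤ᵇ p G v)
    pv≤pv = ℤ.≤⇒≤ᵇ (ℤ.≤-refl {p G v})

  maxLayer⁻ : v ∈ maxLayer G W m → v ∈ W × m ≤ p G v
  maxLayer⁻ v∈ with to T-∧ (to ∈setOf⇔ v∈)
  ... | v∈W , bounds = from ∈⇔T-lookup v∈W , ℤ.≤ᵇ⇒≤ (proj₁ (to T-∧ bounds))

if-elim : ∀ {a p} {A : Set a} (P : A → Set p) b {x y} → P x → P y → P (if b then x else y)
if-elim P true  px _  = px
if-elim P false _  py = py

module SeqAttrRun (P : ParAlgType) {n} (G : Arena n) (σ : Player) where

  -- One round of seqLoop, spelled exactly as in its definition and kept opaque: type checking
  -- becomes very slow whenever GenAttr is unfolded in a goal or compared with a differently
  -- spelled (even definitionally equal) round.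
  opaque
    nextC : Subset n → Subset n → ℤ → Subset n
    nextC W C M = GenAttr G M (C ∪ setOf (λ v → lookup W v ∧ (M ≤ᵇ p G v) ∧ (p G v ≤ᵇ M))) σ P

  nextW : Subset n → Subset n → ℤ → Subset n
  nextW W C M = W ∩ ∁ (nextC W C M)

  ⊆-seqLoop : ∀ k W C → C ⊆ seqLoop k G σ P W C
  ⊆-seqLoop zero    W C = λ x∈ → x∈
  ⊆-seqLoop (suc k) W C with maxPrio G W
  ... | nothing = λ x∈ → x∈
  ... | just M  = ⊆-seqLoop k _ _ ∘ ⊆-GenAttr G M σ P _ ∘ x∈p∪q⁺ ∘ inj₁

  opaque
    unfolding nextC

    ⊆-nextC : ∀ W C M → C ∪ maxLayer G W M ⊆ nextC W C M
    ⊆-nextC W C M = ⊆-GenAttr G M σ P (C ∪ setOf (λ v → lookup W v ∧ (M ≤ᵇ p G v) ∧ (p G v ≤ᵇ M)))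

    nextC-closed : ∀ W C M → genStep G M σ P (nextC W C M) ≡ nextC W C M
    nextC-closed W C M =
      GenAttr-fixpoint G M σ P (C ∪ setOf (λ v → lookup W v ∧ (M ≤ᵇ p G v) ∧ (p G v ≤ᵇ M)))

  ∣nextW∣<∣W∣ : ∀ {W C M v} → v ∈ W → p G v ≡ M → ∣ nextW W C M ∣ <ℕ ∣ W ∣
  ∣nextW∣<∣W∣ {W} {C} {M} {v} v∈W pv≡M = p⊂q⇒∣p∣<∣q∣ (x∈p∩q⇒x∈p , v , v∈W , λ v∈next →
    x∈∁p⇒x∉p (x∈p∩q⇒x∈q v∈next) (⊆-nextC W C M (x∈p∪q⁺ (inj₂ (∈maxLayer {G = G} v∈W pv≡M)))))

  -- the value of C in seqLoop once every vertex of W of priority at least m has been handled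
  seqUntil : ℕ → Subset n → Subset n → ℤ → Subset n
  seqUntil zero    W C m = C
  seqUntil (suc k) W C m with maxPrio G W
  ... | nothing = C
  ... | just M  = if does (m ℤ.≤? M) then seqUntil k (nextW W C M) (nextC W C M) m else C

  ⊆-seqUntil : ∀ k W C m → C ⊆ seqUntil k W C m
  ⊆-seqUntil zero    W C m = λ x∈ → x∈
  ⊆-seqUntil (suc k) W C m with maxPrio G W
  ... | nothing = λ x∈ → x∈
  ... | just M  = if-elim (C ⊆_) (does (m ℤ.≤? M))
                    (⊆-seqUntil k (nextW W C M) (nextC W C M) m ∘ ⊆-nextC W C M ∘ x∈p∪q⁺ ∘ inj₁)
                    (λ x∈ → x∈)

  opaque
    unfolding nextC

    seqUntil⊆seqLoop : ∀ k W C m → seqUntil k W C m ⊆ seqLoop k G σ P W C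
    seqUntil⊆seqLoop zero    W C m = λ x∈ → x∈
    seqUntil⊆seqLoop (suc k) W C m with maxPrio G W
    ... | nothing = λ x∈ → x∈
    ... | just M  = if-elim (_⊆ seqLoop k G σ P (nextW W C M) (nextC W C M)) (does (m ℤ.≤? M))
                      (seqUntil⊆seqLoop k (nextW W C M) (nextC W C M) m)
                      (⊆-seqLoop k (nextW W C M) (nextC W C M) ∘ ⊆-nextC W C M ∘ x∈p∪q⁺ ∘ inj₁)

  seqUntil-antitone : ∀ k W C {m m′} → m ≤ m′ → seqUntil k W C m′ ⊆ seqUntil k W C m
  seqUntil-antitone zero    W C m≤m′ = λ x∈ → x∈
  seqUntil-antitone (suc k) W C {m} {m′} m≤m′ with maxPrio G W
  ... | nothing = λ x∈ → x∈
  ... | just M with m′ ℤ.≤? M | m ℤ.≤? M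
  ...   | yes _    | yes _   = seqUntil-antitone k (nextW W C M) (nextC W C M) m≤m′
  ...   | yes m′≤M | no  m≰M = contradiction (ℤ.≤-trans m≤m′ m′≤M) m≰M
  ...   | no  _    | yes _   =
    ⊆-seqUntil k (nextW W C M) (nextC W C M) m ∘ ⊆-nextC W C M ∘ x∈p∪q⁺ ∘ inj₁
  ...   | no  _    | no  _   = λ x∈ → x∈

  seqUntil-absorbs : ∀ k W C m → ∣ W ∣ <ℕ k → ∀ {w} → w ∈ W → m ≤ p G w → w ∈ seqUntil k W C m
  seqUntil-absorbs (suc k) W C m ∣W∣<k {w} w∈W m≤pw with maxPrio G W | maxPrio-spec G W
  ... | nothing | empty W-empty = contradiction w∈W (W-empty w)
  ... | just M  | attained v∈W pv≡M bound with m ℤ.≤? M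
  ...   | no  m≰M = contradiction (ℤ.≤-trans m≤pw (bound w w∈W)) m≰M
  ...   | yes _ with w ∈? nextC W C M
  ...     | yes w∈next = ⊆-seqUntil k (nextW W C M) (nextC W C M) m w∈next
  ...     | no  w∉next = seqUntil-absorbs k (nextW W C M) (nextC W C M) m
              (ℕ.<-≤-trans (∣nextW∣<∣W∣ v∈W pv≡M) (s≤s⁻¹ ∣W∣<k))
              (x∈p∩q⁺ (w∈W , x∉p⇒x∈∁p w∉next)) m≤pw

  seqUntil-unchanged-or-closed : ∀ k W C m →
    seqUntil k W C m ≡ C ⊎ ∃ λ L → m ≤ L × genStep G L σ P (seqUntil k W C m) ≡ seqUntil k W C m
  seqUntil-unchanged-or-closed zero    W C m = inj₁ refl
  seqUntil-unchanged-or-closed (suc k) W C m with maxPrio G W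
  ... | nothing = inj₁ refl
  ... | just M with m ℤ.≤? M
  ...   | no  _   = inj₁ refl
  ...   | yes m≤M with seqUntil-unchanged-or-closed k (nextW W C M) (nextC W C M) m
  ...     | inj₂ closed    = inj₂ closed
  ...     | inj₁ unchanged =
    inj₂ (M , m≤M , subst (λ X → genStep G M σ P X ≡ X) (sym unchanged) (nextC-closed W C M))

module SeqAttrInTrap (P : ParAlgType) (nice : NiceWithTraps P) {n} {G : Arena n} {σ : Player}
  {A : Subset n} (A-trap : IsTrap G (opp σ) A) (W₀ : Subset n) where

  open SeqAttrRun P G σ

  R : Subset n
  R = seqLoop (suc n) G σ P W₀ ⊥

  R≥ : ℤ → Subset n
  R≥ = seqUntil (suc n) W₀ ⊥

  R≥-absorbs : ∀ {m w} → w ∈ W₀ → m ≤ p G w → w ∈ R≥ m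
  R≥-absorbs {m} = seqUntil-absorbs (suc n) W₀ ⊥ m (s≤s (∣p∣≤n W₀))

  R≥-closed : ∀ {m w} → w ∈ W₀ → m ≤ p G w → ∃ λ L → m ≤ L × genStep G L σ P (R≥ m) ≡ R≥ m
  R≥-closed {m} w∈W₀ m≤pw with seqUntil-unchanged-or-closed (suc n) W₀ ⊥ m
  ... | inj₂ closed    = closed
  ... | inj₁ unchanged = contradiction (subst (_ ∈_) unchanged (R≥-absorbs w∈W₀ m≤pw)) ∉⊥

  -- the round of seqLoop on G [ A ], spelled exactly as there (see SeqAttrRun.nextC)
  roundA : Subset n → Subset n → ℤ → Subset n
  roundA W C M = GenAttr (G [ A ]) M
    (C ∪ setOf (λ u → lookup W u ∧ (M ≤ᵇ p (G [ A ]) u) ∧ (p (G [ A ]) u ≤ᵇ M))) σ P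

  record Invariant (W C : Subset n) : Set where
    field
      W⊆W₀ : W ⊆ W₀
      C⊆R  : C ⊆ R
      C⊆R≥ : ∀ {m w} → w ∈ W → m ≤ p G w → C ⊆ R≥ m

  -- R≥ M is closed under a GenAttr step at some level L ≥ M, so by the subgame lemma
  -- the round at the maximal priority M of the run on G [ A ] stays inside it.
  Invariant-step : ∀ W C M {v} → v ∈ W → p G v ≡ M → (∀ w → w ∈ W → p G w ≤ M) →
                   Invariant W C → Invariant (W ∩ ∁ (roundA W C M)) (roundA W C M)
  Invariant-step W C M v∈W pv≡M bound inv = record
    { W⊆W₀ = W⊆W₀ ∘ x∈p∩q⇒x∈p
    ; C⊆R  = seqUntil⊆seqLoop (suc n) W₀ ⊥ M ∘ round⊆R≥M
    ; C⊆R≥ = λ w∈W′ m≤pw →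
        seqUntil-antitone (suc n) W₀ ⊥ (ℤ.≤-trans m≤pw (bound _ (x∈p∩q⇒x∈p w∈W′))) ∘ round⊆R≥M
    }
    where
    open Invariant inv
    M≤pv : M ≤ p G _
    M≤pv = ℤ.≤-reflexive (sym pv≡M)
    round⊆R≥M : roundA W C M ⊆ R≥ M
    round⊆R≥M = let (L , M≤L , closed) = R≥-closed (W⊆W₀ v∈W) M≤pv in
      GenAttr⊆ (G [ A ]) M σ P
        {C ∪ setOf (λ u → lookup W u ∧ (M ≤ᵇ p (G [ A ]) u) ∧ (p (G [ A ]) u ≤ᵇ M))}
        (λ _ → GenStepInTrap.genStep[]⊆ P nice A-trap M≤L (⊆-reflexive closed))
        (∪-least (C⊆R≥ v∈W M≤pv) λ u∈ → let (u∈W , M≤pu) = maxLayer⁻ {G = G} u∈ in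
          R≥-absorbs (W⊆W₀ u∈W) M≤pu)

  seqLoop[]⊆R : ∀ k W C → Invariant W C → seqLoop k (G [ A ]) σ P W C ⊆ R
  seqLoop[]⊆R zero    W C inv = Invariant.C⊆R inv
  seqLoop[]⊆R (suc k) W C inv with maxPrio (G [ A ]) W | maxPrio-spec (G [ A ]) W
  ... | nothing | _ = Invariant.C⊆R inv
  ... | just M  | attained v∈W pv≡M bound = seqLoop[]⊆R k (W ∩ ∁ (roundA W C M)) (roundA W C M)
                                              (Invariant-step W C M v∈W pv≡M bound inv)

ownedPart : ∀ {n} → Arena n → Subset n → Subset n → Player → Subset n
ownedPart G U X σ = setOf λ v → lookup U v ∧ lookup X v ∧ (owner G v ==P σ)

ownedPart-mono : ∀ {n} {G : Arena n} {U U′ X X′ σ} → U ⊆ U′ → X ⊆ X′ →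
                 ownedPart G U X σ ⊆ ownedPart G U′ X′ σ
ownedPart-mono U⊆U′ X⊆X′ v∈ with to T-∧ (to ∈setOf⇔ v∈)
... | v∈U , rest with to T-∧ rest
...   | v∈X , owned = from ∈setOf⇔ (from T-∧
        ( to ∈⇔T-lookup (U⊆U′ (from ∈⇔T-lookup v∈U))
        , from T-∧ (to ∈⇔T-lookup (X⊆X′ (from ∈⇔T-lookup v∈X)) , owned)))

mainTheorem14 : (ParAlg : ParAlgType) → NiceWithTraps ParAlg →
    ∀ {n} (σ : Player) (G : Arena n) (X₁ X₂ A : Subset n) →
    IsParityGame G → X₁ ⊆ X₂ → IsTrap G (opp σ) A → X₁ ⊆ A →
    SeqAttr (G [ A ]) X₁ σ ParAlg ⊆ SeqAttr G X₂ σ ParAlg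
mainTheorem14 P nice {n} σ G X₁ X₂ A _ X₁⊆X₂ A-trap _ =
  seqLoop[]⊆R (suc n) (ownedPart G (V G ∩ A) X₁ σ) ⊥ start
  where
  open SeqAttrInTrap P nice {G = G} A-trap (ownedPart G (V G) X₂ σ)
  start : Invariant (ownedPart G (V G ∩ A) X₁ σ) ⊥
  start = record
    { W⊆W₀ = ownedPart-mono {G = G} {V G ∩ A} {V G} {X₁} {X₂} {σ} x∈p∩q⇒x∈p X₁⊆X₂
    ; C⊆R  = ⊥⊆
    ; C⊆R≥ = λ _ _ → ⊥⊆
    }
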